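{- Let $n\geq 4$ be an integer and let $W_n$ be the wheel graph of order $n$. Then \[\mathrm{ldim}_{\mathrm{f}}(W_n)=\begin{cases}2,&\text{if } n=4,\\ \frac 32,&\text{if } n\in\{5,6\},\\ \frac{n-1}{4},&\text{otherwise (i.e. } n\geq 7).\end{cases}\]
   Context: The wheel graph $W_n$ of order $n$ is obtained from a cycle on $n-1$ vertices by adding one new vertex (the center) adjacent to all vertices of the cycle. For a finite connected graph $G$, $d(u,v)$ denotes the shortest-path distance, and for vertices $v,w$ the resolving neighbourhood is $\mathcal{R}\{v,w\}=\{u\in V(G)\colon d(v,u)\neq d(w,u)\}$. A local resolving function of $G$ is a map $\vartheta\colon V(G)\to[0,1]$ such that $\sum_{u\in\mathcal{R}\{v,w\}}\vartheta(u)\geq 1$ for every edge $vw\in E(G)$. The local fractional metric dimension is $\mathrm{ldim}_{\mathrm{f}}(G)=\min\{\sum_{v\in V(G)}\vartheta(v)\colon \vartheta \text{ is a local resolving function of } G\}$.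
   Formalization: Local resolving functions ϑ take rational rather than real values in $[0,1]$. -}

module Defs where

open import Data.Nat as ℕ using (ℕ; zero; suc; _∸_)
open import Data.Integer using (+_)
open import Data.Fin using (Fin; toℕ)
open import Data.Fin as Fin using ()
open import Data.List using (List; foldr; map; filterᵇ)
open import Data.Bool.ListAction using (any)
open import Data.Fin.Base using ()
open import Data.Bool using (Bool; true; false; _∧_; _∨_; not; if_then_else_)
open import Data.Rational using (ℚ; 0ℚ; 1ℚ; _+_; _≤_; _/_)
open import Data.Product using (Σ; _×_)
open import Data.Vec.Functional using ()
open import Data.List using (allFin)
open import Relation.Binary.PropositionalEquality using (_≡_)

Graph : ℕ → Set
Graph n = Fin n → Fin n → Bool

reach : ∀ {n} → Graph n → ℕ → Fin n → Fin n → Bool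
reach G zero    u v = toℕ u ℕ.≡ᵇ toℕ v
reach G (suc k) u v = reach G k u v ∨ any (λ w → G u w ∧ reach G k w v) (allFin _)

-- least k ≤ bound with reach G k u v (returns bound if none)
firstReach : ∀ {n} → Graph n → ℕ → ℕ → Fin n → Fin n → ℕ
firstReach G k zero      u v = k
firstReach G k (suc fuel) u v =
  if reach G k u v then k else firstReach G (suc k) fuel u v

-- Shortest-path distance d(u,v) (correct for connected graphs, where d(u,v) < n).
dist : ∀ {n} → Graph n → Fin n → Fin n → ℕ
dist {n} G u v = firstReach G 0 n u v

cycAdj : (m : ℕ) → Fin m → Fin m → Bool
cycAdj m i j =
  (suc (toℕ i) ℕ.≡ᵇ toℕ j) ∨ (suc (toℕ j) ℕ.≡ᵇ toℕ i)
  ∨ ((toℕ i ℕ.≡ᵇ 0) ∧ (suc (toℕ j) ℕ.≡ᵇ m))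
  ∨ ((toℕ j ℕ.≡ᵇ 0) ∧ (suc (toℕ i) ℕ.≡ᵇ m))

-- Wheel graph W_n of order n: vertex 0 is the center, vertices 1,…,n-1 form
-- a cycle C_{n-1}, and the center is adjacent to every cycle vertex.
wheel : (n : ℕ) → Graph n
wheel zero    ()
wheel (suc m) Fin.zero    Fin.zero    = false
wheel (suc m) Fin.zero    (Fin.suc _) = true
wheel (suc m) (Fin.suc _) Fin.zero    = true
wheel (suc m) (Fin.suc i) (Fin.suc j) = cycAdj m i j

sumℚ : ∀ {n} → (Fin n → ℚ) → ℚ
sumℚ {n} f = foldr _+_ 0ℚ (map f (allFin n))

resolvesᵇ : ∀ {n} → Graph n → Fin n → Fin n → Fin n → Bool
resolvesᵇ G v w u = not (dist G v u ℕ.≡ᵇ dist G w u)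

resolvingSum : ∀ {n} → Graph n → (Fin n → ℚ) → Fin n → Fin n → ℚ
resolvingSum G ϑ v w = sumℚ (λ u → if resolvesᵇ G v w u then ϑ u else 0ℚ)

IsLocalResolvingFunction : ∀ {n} → Graph n → (Fin n → ℚ) → Set
IsLocalResolvingFunction G ϑ =
  (∀ u → (0ℚ ≤ ϑ u) × (ϑ u ≤ 1ℚ))
  × (∀ v w → G v w ≡ true → 1ℚ ≤ resolvingSum G ϑ v w)

LdimF≡ : ∀ {n} → Graph n → ℚ → Set
LdimF≡ G r =
  Σ (_ → ℚ) (λ ϑ → IsLocalResolvingFunction G ϑ × (sumℚ ϑ ≡ r))
  × (∀ ϑ → IsLocalResolvingFunction G ϑ → r ≤ sumℚ ϑ)

ldimWheel : ℕ → ℚ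
ldimWheel 4 = + 2 / 1
ldimWheel 5 = + 3 / 2
ldimWheel 6 = + 3 / 2
ldimWheel n = + (n ∸ 1) / 4

module Submission where

-- In W_n any two vertices are at distance at most 2 (through the centre), so a vertex u
-- resolves an edge vw iff u ∈ {v, w} or u is adjacent to exactly one of v and w.  Identify
-- the rim with ℤ/(n−1): its rotations are automorphisms of the wheel, so whether a rim
-- vertex resolves a rim edge or a spoke depends only on finitely many offsets.
--
-- For n ≥ 7 the rim edge {x+1, x+2} is resolved exactly by the rim vertices x, …, x+3, and
-- among the rim vertices the spoke to y is resolved by y and the n−4 vertices not adjacent
-- to y.  So the weight 1/4 on every rim vertex is a local resolving function of total weight
-- (n−1)/4.  Conversely, adding the constraints of the n−1 rim edges gives n−1 ≤ 4 Σϑ, as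
-- every rim vertex lies in exactly four of the windows x, …, x+3.
--
-- For n ∈ {4, 5, 6} both bounds are finite computations: an explicit resolving function,
-- and a list of L edges such that every vertex resolves exactly k of them, so that adding
-- their constraints gives L ≤ k Σϑ.

open import Data.Bool using (Bool; true; false; T; _∧_; _∨_; not; if_then_else_)
import Data.Bool.Properties as Bool
open import Data.Bool.ListAction using (any)
open import Data.Empty using (⊥-elim)
open import Data.Fin using (Fin; zero; suc; toℕ; _↑ˡ_; punchIn)
open import Data.Fin.Patterns using (0F; 1F; 2F; 3F; 4F; 5F)
open import Data.Fin.Permutation using (permutation)
open import Data.Fin.Properties
  using (_≟_; all?; 0≢1+n; suc-injective; toℕ-injective; toℕ-fromℕ<; toℕ<n; ↑ˡ-injective; punchIn-injective)
import Data.Integer as ℤ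
open import Data.Integer.Solver using (module +-*-Solver)
open import Data.List using ([]; _∷_; foldr; map; tabulate; allFin)
open import Data.List.Membership.Propositional using (lose)
open import Data.List.Membership.Propositional.Properties using (∈-allFin)
open import Data.List.Relation.Unary.Any using (satisfied)
open import Data.List.Relation.Unary.Any.Properties using (any⁺; any⁻)
open import Data.Nat as ℕ using (ℕ; zero; suc; s≤s)
open import Data.Nat.DivMod using (_mod_; %-distribˡ-+; m%n%n≡m%n; m<n⇒m%n≡m; n%n≡0; m*n%n≡0)
import Data.Nat.Properties as ℕP
open import Data.Product using (_×_; _,_; proj₁; proj₂; ∃-syntax)
open import Data.Rational using (ℚ; 0ℚ; 1ℚ; _+_; _≤_; _<_; _/_; _≤?_; toℚᵘ)
open import Data.Rational.Properties as ℚ using (≤-refl; ≤-trans; +-mono-≤; +-identityˡ; +-identityʳ)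
import Data.Rational.Unnormalised as ℚᵘ
open ℚᵘ using (mkℚᵘ)
import Data.Rational.Unnormalised.Properties as ℚᵘP
open import Data.Sum using (_⊎_; inj₁; inj₂)
open import Data.Vec.Functional using (fromList)
open import Function using (_∘_)
open import Function.Bundles using (_⇔_; mk⇔; Equivalence)
open import Function.Definitions using (Injective)
open import Relation.Binary.PropositionalEquality
open import Relation.Nullary using (does; yes; no)
open import Relation.Nullary.Decidable
  using (Dec; T?; True; toWitness; from-yes; dec-true; dec-false; does-⇔; _×-dec_; _→-dec_)

open import Algebra.Properties.CommutativeMonoid.Sum ℚ.+-0-commutativeMonoid
  using (sum; sum-syntax; sum-cong-≗; sum-replicate; sum-replicate-zero; ∑-comm; ∑-distrib-+; ∑-permute)
open import Algebra.Properties.Monoid.Mult ℚ.+-0-monoid using (×-assocˡ) renaming (_×_ to _·_)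

open import Defs

sumℚ≡sum : ∀ {n} (f : Fin n → ℚ) → sumℚ f ≡ sum f
sumℚ≡sum {n} f = foldr-map-tabulate (λ u → u)
  where
  foldr-map-tabulate : ∀ {r} (a : Fin r → Fin n) → foldr _+_ 0ℚ (map f (tabulate a)) ≡ sum (f ∘ a)
  foldr-map-tabulate {zero}  a = refl
  foldr-map-tabulate {suc r} a = cong (f (a zero) +_) (foldr-map-tabulate (a ∘ suc))

sum-mono-≤ : ∀ {n} {f g : Fin n → ℚ} → (∀ i → f i ≤ g i) → sum f ≤ sum g
sum-mono-≤ {zero}  f≤g = ≤-refl
sum-mono-≤ {suc n} f≤g = +-mono-≤ (f≤g zero) (sum-mono-≤ (f≤g ∘ suc))

sum-nonNeg : ∀ {n} {f : Fin n → ℚ} → (∀ i → 0ℚ ≤ f i) → 0ℚ ≤ sum f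
sum-nonNeg {n} {f} f≥0 = subst (_≤ sum f) (sum-replicate-zero n) (sum-mono-≤ f≥0)

≤-sum : ∀ {n} {f : Fin n → ℚ} → (∀ i → 0ℚ ≤ f i) → ∀ i → f i ≤ sum f
≤-sum {suc n} {f} f≥0 zero    =
  subst (_≤ sum f) (+-identityʳ (f zero)) (+-mono-≤ (≤-refl {f zero}) (sum-nonNeg (f≥0 ∘ suc)))
≤-sum {suc n} {f} f≥0 (suc i) =
  subst (_≤ sum f) (+-identityˡ (f (suc i))) (+-mono-≤ (f≥0 zero) (≤-sum (f≥0 ∘ suc) i))

indicator-nonNeg : ∀ b {x} → 0ℚ ≤ x → 0ℚ ≤ (if b then x else 0ℚ)
indicator-nonNeg true  x≥0 = x≥0
indicator-nonNeg false _   = ≤-refl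

sum-select : ∀ {n} (a : Fin n) (f : Fin n → ℚ) → ∑[ u < n ] (if does (u ≟ a) then f u else 0ℚ) ≡ f a
sum-select {suc n} zero    f = trans (cong (f zero +_) (sum-replicate-zero n)) (+-identityʳ (f zero))
sum-select {suc n} (suc a) f = trans (+-identityˡ _) (sum-select a (f ∘ suc))

sum-pick : ∀ {n} (a : Fin n) (f : Fin n → ℚ) → sum f ≡ f a + ∑[ u < n ] (if does (u ≟ a) then 0ℚ else f u)
sum-pick {n} a f = begin
  sum f                             ≡⟨ sum-cong-≗ split ⟩
  ∑[ u < n ] (selected u + rest u)  ≡⟨ ∑-distrib-+ selected rest ⟩
  sum selected + sum rest           ≡⟨ cong (_+ sum rest) (sum-select a f) ⟩
  f a + sum rest                    ∎
  where
  open ≡-Reasoning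
  selected rest : Fin n → ℚ
  selected u = if does (u ≟ a) then f u else 0ℚ
  rest     u = if does (u ≟ a) then 0ℚ else f u
  split : ∀ u → f u ≡ selected u + rest u
  split u with does (u ≟ a)
  ... | true  = sym (+-identityʳ (f u))
  ... | false = sym (+-identityˡ (f u))

sum-injective-≤ : ∀ {n r} {f : Fin n → ℚ} (a : Fin r → Fin n) → Injective _≡_ _≡_ a →
                  (∀ u → 0ℚ ≤ f u) → ∑[ k < r ] f (a k) ≤ sum f
sum-injective-≤ {r = zero}      a a-inj f≥0 = sum-nonNeg f≥0
sum-injective-≤ {n} {suc r} {f} a a-inj f≥0 = begin
  f (a zero) + ∑[ k < r ] f (a (suc k))  ≡⟨ cong (f (a zero) +_) (sum-cong-≗ unchanged) ⟩
  f (a zero) + ∑[ k < r ] g (a (suc k))  ≤⟨ ℚ.+-monoʳ-≤ (f (a zero)) rest-≤ ⟩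
  f (a zero) + sum g                     ≡⟨ sum-pick (a zero) f ⟨
  sum f                                  ∎
  where
  open ℚ.≤-Reasoning
  g : Fin n → ℚ
  g u = if does (u ≟ a zero) then 0ℚ else f u
  g≥0 : ∀ u → 0ℚ ≤ g u
  g≥0 u with does (u ≟ a zero)
  ... | true  = ≤-refl
  ... | false = f≥0 u
  unchanged : ∀ k → f (a (suc k)) ≡ g (a (suc k))
  unchanged k rewrite dec-false (a (suc k) ≟ a zero) (λ e → 0≢1+n (sym (a-inj e))) = refl
  rest-≤ : ∑[ k < r ] g (a (suc k)) ≤ sum g
  rest-≤ = sum-injective-≤ (a ∘ suc) (suc-injective ∘ a-inj) g≥0

sum-covered-≤ : ∀ {n r} {P : Fin n → Bool} {f : Fin n → ℚ} (a : Fin r → Fin n) →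
                (∀ u → 0ℚ ≤ f u) → (∀ u → P u ≡ true → ∃[ k ] u ≡ a k) →
                ∑[ u < n ] (if P u then f u else 0ℚ) ≤ ∑[ k < r ] f (a k)
sum-covered-≤ {n} {r} {P} {f} a f≥0 covered = begin
  ∑[ u < n ] (if P u then f u else 0ℚ)    ≤⟨ sum-mono-≤ below ⟩
  ∑[ u < n ] ∑[ k < r ] hit u k          ≡⟨ ∑-comm hit ⟩
  ∑[ k < r ] ∑[ u < n ] hit u k          ≡⟨ sum-cong-≗ (λ k → sum-select (a k) f) ⟩
  ∑[ k < r ] f (a k)                     ∎
  where
  open ℚ.≤-Reasoning
  hit : Fin n → Fin r → ℚ
  hit u k = if does (u ≟ a k) then f u else 0ℚ
  below : ∀ u → (if P u then f u else 0ℚ) ≤ ∑[ k < r ] hit u k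
  below u with P u in Pu
  ... | false = sum-nonNeg (λ k → indicator-nonNeg (does (u ≟ a k)) (f≥0 u))
  ... | true with covered u Pu
  ... | k , refl = ≤-trans (ℚ.≤-reflexive (cong (λ b → if b then f (a k) else 0ℚ) (sym hit-k)))
                           (≤-sum (λ l → indicator-nonNeg (does (a k ≟ a l)) (f≥0 (a k))) k)
    where
    hit-k : does (a k ≟ a k) ≡ true
    hit-k = dec-true (a k ≟ a k) refl

·-mono-≤ : ∀ k {p q} → p ≤ q → k · p ≤ k · q
·-mono-≤ zero    p≤q = ≤-refl
·-mono-≤ (suc k) p≤q = +-mono-≤ p≤q (·-mono-≤ k p≤q)

·-cancelˡ-≤ : ∀ k {p q} → suc k · p ≤ suc k · q → p ≤ q
·-cancelˡ-≤ k {p} {q} kp≤kq with p ≤? q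
... | yes p≤q = p≤q
... | no  p≰q = ⊥-elim (ℚ.<-irrefl refl (ℚ.<-≤-trans kq<kp kp≤kq))
  where
  q<p : q < p
  q<p = ℚ.≰⇒> p≰q
  kq<kp : suc k · q < suc k · p
  kq<kp = ℚ.+-mono-<-≤ q<p (·-mono-≤ k (ℚ.<⇒≤ q<p))

count : ∀ {L} → (Fin L → Bool) → ℕ
count {zero}  b = 0
count {suc L} b = (if b zero then 1 else 0) ℕ.+ count (b ∘ suc)

sum-indicator : ∀ {L} (b : Fin L → Bool) x → ∑[ i < L ] (if b i then x else 0ℚ) ≡ count b · x
sum-indicator {zero}  b x = refl
sum-indicator {suc L} b x with b zero
... | true  = cong (x +_) (sum-indicator (b ∘ suc) x)
... | false = trans (+-identityˡ _) (sum-indicator (b ∘ suc) x)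

·-distrib-sum : ∀ {n} k (f : Fin n → ℚ) → k · sum f ≡ ∑[ u < n ] (k · f u)
·-distrib-sum {n} k f = begin
  k · sum f                  ≡⟨ sum-replicate k {sum f} ⟨
  ∑[ i < k ] ∑[ u < n ] f u  ≡⟨ ∑-comm {k} {n} (λ _ u → f u) ⟩
  ∑[ u < n ] ∑[ i < k ] f u  ≡⟨ sum-cong-≗ (λ u → sum-replicate k {f u}) ⟩
  ∑[ u < n ] (k · f u)       ∎
  where open ≡-Reasoning

¼ : ℚ
¼ = ℤ.+ 1 / 4

-- `mkℚᵘ p 3` is p/4: unnormalised rationals store the denominator minus one.
·-¼ : ∀ m → m · ¼ ≡ ℤ.+ m / 4
·-¼ zero    = refl
·-¼ (suc m) = trans (cong (¼ +_) (·-¼ m)) (ℚ.toℚᵘ-injective (begin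
  toℚᵘ (¼ + ℤ.+ m / 4)                ≈⟨ ℚ.toℚᵘ-homo-+ ¼ (ℤ.+ m / 4) ⟩
  toℚᵘ ¼ ℚᵘ.+ toℚᵘ (ℤ.+ m / 4)        ≈⟨ ℚᵘP.+-congʳ (toℚᵘ ¼) (ℚ.toℚᵘ-fromℚᵘ (mkℚᵘ (ℤ.+ m) 3)) ⟩
  mkℚᵘ (ℤ.+ 1) 3 ℚᵘ.+ mkℚᵘ (ℤ.+ m) 3  ≈⟨ ℚᵘ.*≡* (solve 1 (λ x → (con (ℤ.+ 4) :+ x :* con (ℤ.+ 4)) :* con (ℤ.+ 4)
                                                        := (con (ℤ.+ 1) :+ x) :* con (ℤ.+ 16)) refl (ℤ.+ m)) ⟩
  mkℚᵘ (ℤ.+ suc m) 3                  ≈⟨ ℚ.toℚᵘ-fromℚᵘ (mkℚᵘ (ℤ.+ suc m) 3) ⟨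
  toℚᵘ (ℤ.+ suc m / 4)                ∎))
  where
  open ℚᵘP.≃-Reasoning
  open +-*-Solver

toℕ-≡ᵇ : ∀ {n} (u v : Fin n) → (toℕ u ℕ.≡ᵇ toℕ v) ≡ does (u ≟ v)
toℕ-≡ᵇ u v = does-⇔ (mk⇔ (toℕ-injective ∘ ℕP.≡ᵇ⇒≡ _ _) (ℕP.≡⇒≡ᵇ _ _ ∘ cong toℕ))
                     (T? (toℕ u ℕ.≡ᵇ toℕ v)) (u ≟ v)

module _ {n} (G : Graph n) where

  dist₂ : Fin n → Fin n → ℕ
  dist₂ u v = if does (u ≟ v) then 0 else if G u v then 1 else 2

  reach₁≡ : ∀ u v → reach G 1 u v ≡ does (u ≟ v) ∨ G u v
  reach₁≡ u v = cong₂ _∨_ (toℕ-≡ᵇ u v) (does-⇔ (mk⇔ via-neighbour to-neighbour) (T? _) (T? (G u v)))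
    where
    step : Fin n → Bool
    step w = G u w ∧ reach G 0 w v
    via-neighbour : T (any step (allFin n)) → T (G u v)
    via-neighbour t with satisfied (any⁻ step (allFin n) t)
    ... | w , t-step with Equivalence.to (Bool.T-∧ {G u w}) t-step
    ... | t-G , t-w≡v rewrite toℕ-injective (ℕP.≡ᵇ⇒≡ (toℕ w) (toℕ v) t-w≡v) = t-G
    to-neighbour : T (G u v) → T (any step (allFin n))
    to-neighbour t = any⁺ step (lose (∈-allFin v) (Equivalence.from (Bool.T-∧ {G u v}) (t , v≡v)))
      where
      v≡v : T (toℕ v ℕ.≡ᵇ toℕ v)
      v≡v = ℕP.≡⇒≡ᵇ (toℕ v) (toℕ v) refl

dist≡dist₂ : ∀ {k} (G : Graph (suc (suc (suc k)))) u v → reach G 2 u v ≡ true → dist G u v ≡ dist₂ G u v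
dist≡dist₂ G u v reach₂ = first-of-three (does (u ≟ v)) (G u v) (toℕ-≡ᵇ u v) (reach₁≡ G u v) reach₂
  where
  first-of-three : ∀ {b₀ b₁ b₂ x} c g → b₀ ≡ c → b₁ ≡ c ∨ g → b₂ ≡ true →
                   (if b₀ then 0 else if b₁ then 1 else if b₂ then 2 else x) ≡ (if c then 0 else if g then 1 else 2)
  first-of-three true  g     refl refl refl = refl
  first-of-three false true  refl refl refl = refl
  first-of-three false false refl refl refl = refl

module _ (k : ℕ) where

  private
    W : Graph (suc (suc (suc k)))
    W = wheel (suc (suc (suc k)))

  wheel-reach₁-centre : ∀ v → reach W 1 zero v ≡ true
  wheel-reach₁-centre zero    = reach₁≡ W zero zero
  wheel-reach₁-centre (suc v) = reach₁≡ W zero (suc v)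

  wheel-reach₂ : ∀ u v → reach W 2 u v ≡ true
  wheel-reach₂ zero    v = cong (_∨ any (λ w → W zero w ∧ reach W 1 w v) (allFin _)) (wheel-reach₁-centre v)
  wheel-reach₂ (suc i) v = trans
    (cong (λ b → reach W 1 (suc i) v ∨ b ∨ any (λ w → W (suc i) w ∧ reach W 1 w v) (tabulate suc))
          (wheel-reach₁-centre v))
    (Bool.∨-zeroʳ (reach W 1 (suc i) v))

≡ᵇ-comm : ∀ m n → (m ℕ.≡ᵇ n) ≡ (n ℕ.≡ᵇ m)
≡ᵇ-comm m n = does-⇔ (mk⇔ sym sym) (m ℕ.≟ n) (n ℕ.≟ m)

module _ {n} (G : Graph n) where

  resolvingSum≡sum : ∀ ϑ v w → resolvingSum G ϑ v w ≡ ∑[ u < n ] (if resolvesᵇ G v w u then ϑ u else 0ℚ)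
  resolvingSum≡sum ϑ v w = sumℚ≡sum (λ u → if resolvesᵇ G v w u then ϑ u else 0ℚ)

  resolvingSum-comm : ∀ ϑ v w → resolvingSum G ϑ v w ≡ resolvingSum G ϑ w v
  resolvingSum-comm ϑ v w = begin
    resolvingSum G ϑ v w                                 ≡⟨ resolvingSum≡sum ϑ v w ⟩
    ∑[ u < n ] (if resolvesᵇ G v w u then ϑ u else 0ℚ)  ≡⟨ sum-cong-≗ (λ u → cong (λ b → if not b then ϑ u else 0ℚ)
                                                                                (≡ᵇ-comm (dist G v u) (dist G w u))) ⟩
    ∑[ u < n ] (if resolvesᵇ G w v u then ϑ u else 0ℚ)  ≡⟨ resolvingSum≡sum ϑ w v ⟨
    resolvingSum G ϑ w v                                 ∎
    where open ≡-Reasoning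

  resolvingSum-≥ : ∀ {r} ϑ v w (a : Fin r → Fin n) → Injective _≡_ _≡_ a → (∀ u → 0ℚ ≤ ϑ u) →
                   (∀ k → resolvesᵇ G v w (a k) ≡ true) → ∑[ k < r ] ϑ (a k) ≤ resolvingSum G ϑ v w
  resolvingSum-≥ {r} ϑ v w a a-inj ϑ≥0 resolved = begin
    ∑[ k < r ] ϑ (a k)             ≡⟨ sum-cong-≗ (λ k → cong (λ b → if b then ϑ (a k) else 0ℚ) (resolved k)) ⟨
    ∑[ k < r ] summand (a k)       ≤⟨ sum-injective-≤ a a-inj summand≥0 ⟩
    ∑[ u < n ] summand u           ≡⟨ resolvingSum≡sum ϑ v w ⟨
    resolvingSum G ϑ v w           ∎
    where
    open ℚ.≤-Reasoning
    summand : Fin n → ℚ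
    summand u = if resolvesᵇ G v w u then ϑ u else 0ℚ
    summand≥0 : ∀ u → 0ℚ ≤ summand u
    summand≥0 u = indicator-nonNeg (resolvesᵇ G v w u) (ϑ≥0 u)

  resolvingSum-≤ : ∀ {r} ϑ v w (a : Fin r → Fin n) → (∀ u → 0ℚ ≤ ϑ u) →
                   (∀ u → resolvesᵇ G v w u ≡ true → ∃[ k ] u ≡ a k) →
                   resolvingSum G ϑ v w ≤ ∑[ k < r ] ϑ (a k)
  resolvingSum-≤ ϑ v w a ϑ≥0 covered =
    subst (_≤ _) (sym (resolvingSum≡sum ϑ v w)) (sum-covered-≤ a ϑ≥0 covered)

  isLocalResolvingFunction? : ∀ ϑ → Dec (IsLocalResolvingFunction G ϑ)
  isLocalResolvingFunction? ϑ =
    all? (λ u → (0ℚ ≤? ϑ u) ×-dec (ϑ u ≤? 1ℚ))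
    ×-dec all? (λ v → all? (λ w → (G v w Bool.≟ true) →-dec (1ℚ ≤? resolvingSum G ϑ v w)))

  module _ {L} (es : Fin L → Fin n × Fin n) where

    edgeSum : (Fin n → ℚ) → ℚ
    edgeSum ϑ = ∑[ i < L ] resolvingSum G ϑ (proj₁ (es i)) (proj₂ (es i))

    resolvedBy : Fin n → Fin L → Bool
    resolvedBy u i = resolvesᵇ G (proj₁ (es i)) (proj₂ (es i)) u

    edgeSum-≥ : (∀ i → G (proj₁ (es i)) (proj₂ (es i)) ≡ true) →
                ∀ ϑ → IsLocalResolvingFunction G ϑ → L · 1ℚ ≤ edgeSum ϑ
    edgeSum-≥ edges ϑ (_ , resolving) =
      subst (_≤ edgeSum ϑ) (sum-replicate L {1ℚ}) (sum-mono-≤ (λ i → resolving _ _ (edges i)))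

    edgeSum≡ : ∀ k → (∀ u → count (resolvedBy u) ≡ k) → ∀ ϑ → edgeSum ϑ ≡ k · sumℚ ϑ
    edgeSum≡ k uniform ϑ = begin
      edgeSum ϑ                                ≡⟨ sum-cong-≗ (λ i → sumℚ≡sum (term i)) ⟩
      ∑[ i < L ] ∑[ u < n ] term i u           ≡⟨ ∑-comm term ⟩
      ∑[ u < n ] ∑[ i < L ] term i u           ≡⟨ sum-cong-≗ (λ u → sum-indicator (resolvedBy u) (ϑ u)) ⟩
      ∑[ u < n ] (count (resolvedBy u) · ϑ u)  ≡⟨ sum-cong-≗ (λ u → cong (_· ϑ u) (uniform u)) ⟩
      ∑[ u < n ] (k · ϑ u)                     ≡⟨ ·-distrib-sum k ϑ ⟨
      k · sum ϑ                                ≡⟨ cong (k ·_) (sumℚ≡sum ϑ) ⟨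
      k · sumℚ ϑ                               ∎
      where
      open ≡-Reasoning
      term : Fin L → Fin n → ℚ
      term i u = if resolvedBy u i then ϑ u else 0ℚ

    ldimF-≥-doubleCounting : ∀ k r → (∀ i → G (proj₁ (es i)) (proj₂ (es i)) ≡ true) →
                             (∀ u → count (resolvedBy u) ≡ suc k) → suc k · r ≡ L · 1ℚ →
                             ∀ ϑ → IsLocalResolvingFunction G ϑ → r ≤ sumℚ ϑ
    ldimF-≥-doubleCounting k r edges uniform kr≡L ϑ lrf = ·-cancelˡ-≤ k (begin
      suc k · r       ≡⟨ kr≡L ⟩
      L · 1ℚ          ≤⟨ edgeSum-≥ edges ϑ lrf ⟩
      edgeSum ϑ       ≡⟨ edgeSum≡ (suc k) uniform ϑ ⟩
      suc k · sumℚ ϑ  ∎)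
      where open ℚ.≤-Reasoning

ldimF≡-certified : ∀ {n} {L} (G : Graph n) (ϑ : Fin n → ℚ) (es : Fin L → Fin n × Fin n) k →
  {_ : True (isLocalResolvingFunction? G ϑ)} →
  {_ : True (all? λ i → G (proj₁ (es i)) (proj₂ (es i)) Bool.≟ true)} →
  {_ : True (all? λ u → count (resolvedBy G es u) ℕ.≟ suc k)} →
  {_ : True (suc k · sumℚ ϑ ℚ.≟ L · 1ℚ)} →
  LdimF≡ G (sumℚ ϑ)
ldimF≡-certified {L = L} G ϑ es k {lrf} {edges} {uniform} {kϑ≡L} =
  (ϑ , toWitness lrf , refl) ,
  ldimF-≥-doubleCounting G es k (sumℚ ϑ) (toWitness edges) (toWitness uniform) (toWitness kϑ≡L)

module Cyclic (m : ℕ) .{{_ : ℕ.NonZero m}} where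

  infixl 6 _⊕_

  _⊕_ : Fin m → Fin m → Fin m
  x ⊕ y = (toℕ x ℕ.+ toℕ y) mod m

  ⊖_ : Fin m → Fin m
  ⊖ x = (m ℕ.∸ toℕ x) mod m

  0̂ 1̂ : Fin m
  0̂ = 0 mod m
  1̂ = 1 mod m

  toℕ-mod : ∀ a → toℕ (a mod m) ≡ a ℕ.% m
  toℕ-mod a = toℕ-fromℕ< _

  toℕ-0̂ : toℕ 0̂ ≡ 0
  toℕ-0̂ = trans (toℕ-mod 0) (m*n%n≡0 0 m)

  toℕ-⊕ : ∀ x y → toℕ (x ⊕ y) ≡ (toℕ x ℕ.+ toℕ y) ℕ.% m
  toℕ-⊕ x y = toℕ-mod (toℕ x ℕ.+ toℕ y)

  %-absorbˡ : ∀ a b → (a ℕ.% m ℕ.+ b) ℕ.% m ≡ (a ℕ.+ b) ℕ.% m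
  %-absorbˡ a b = begin
    (a ℕ.% m ℕ.+ b) ℕ.% m              ≡⟨ %-distribˡ-+ (a ℕ.% m) b m ⟩
    (a ℕ.% m ℕ.% m ℕ.+ b ℕ.% m) ℕ.% m  ≡⟨ cong (λ c → (c ℕ.+ b ℕ.% m) ℕ.% m) (m%n%n≡m%n a m) ⟩
    (a ℕ.% m ℕ.+ b ℕ.% m) ℕ.% m        ≡⟨ %-distribˡ-+ a b m ⟨
    (a ℕ.+ b) ℕ.% m                    ∎
    where open ≡-Reasoning

  %-absorbʳ : ∀ a b → (a ℕ.+ b ℕ.% m) ℕ.% m ≡ (a ℕ.+ b) ℕ.% m
  %-absorbʳ a b = trans (cong (ℕ._% m) (ℕP.+-comm a _))
                        (trans (%-absorbˡ b a) (cong (ℕ._% m) (ℕP.+-comm b a)))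

  ⊕-comm : ∀ x y → x ⊕ y ≡ y ⊕ x
  ⊕-comm x y = cong (_mod m) (ℕP.+-comm (toℕ x) (toℕ y))

  ⊕-assoc : ∀ x y z → x ⊕ y ⊕ z ≡ x ⊕ (y ⊕ z)
  ⊕-assoc x y z = toℕ-injective (begin
    toℕ (x ⊕ y ⊕ z)                                ≡⟨ toℕ-⊕ (x ⊕ y) z ⟩
    (toℕ (x ⊕ y) ℕ.+ toℕ z) ℕ.% m                  ≡⟨ cong (λ c → (c ℕ.+ toℕ z) ℕ.% m) (toℕ-⊕ x y) ⟩
    ((toℕ x ℕ.+ toℕ y) ℕ.% m ℕ.+ toℕ z) ℕ.% m      ≡⟨ %-absorbˡ (toℕ x ℕ.+ toℕ y) (toℕ z) ⟩
    (toℕ x ℕ.+ toℕ y ℕ.+ toℕ z) ℕ.% m              ≡⟨ cong (ℕ._% m) (ℕP.+-assoc (toℕ x) (toℕ y) (toℕ z)) ⟩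
    (toℕ x ℕ.+ (toℕ y ℕ.+ toℕ z)) ℕ.% m            ≡⟨ %-absorbʳ (toℕ x) (toℕ y ℕ.+ toℕ z) ⟨
    (toℕ x ℕ.+ (toℕ y ℕ.+ toℕ z) ℕ.% m) ℕ.% m      ≡⟨ cong (λ c → (toℕ x ℕ.+ c) ℕ.% m) (toℕ-⊕ y z) ⟨
    (toℕ x ℕ.+ toℕ (y ⊕ z)) ℕ.% m                  ≡⟨ toℕ-⊕ x (y ⊕ z) ⟨
    toℕ (x ⊕ (y ⊕ z))                              ∎)
    where open ≡-Reasoning

  ⊕-identityʳ : ∀ x → x ⊕ 0̂ ≡ x
  ⊕-identityʳ x = toℕ-injective (begin
    toℕ (x ⊕ 0̂)               ≡⟨ toℕ-⊕ x 0̂ ⟩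
    (toℕ x ℕ.+ toℕ 0̂) ℕ.% m   ≡⟨ cong (λ c → (toℕ x ℕ.+ c) ℕ.% m) toℕ-0̂ ⟩
    (toℕ x ℕ.+ 0) ℕ.% m       ≡⟨ cong (ℕ._% m) (ℕP.+-identityʳ (toℕ x)) ⟩
    toℕ x ℕ.% m               ≡⟨ m<n⇒m%n≡m (toℕ<n x) ⟩
    toℕ x                     ∎)
    where open ≡-Reasoning

  ⊕-inverseʳ : ∀ x → x ⊕ ⊖ x ≡ 0̂
  ⊕-inverseʳ x = toℕ-injective (begin
    toℕ (x ⊕ ⊖ x)                            ≡⟨ toℕ-⊕ x (⊖ x) ⟩
    (toℕ x ℕ.+ toℕ (⊖ x)) ℕ.% m              ≡⟨ cong (λ c → (toℕ x ℕ.+ c) ℕ.% m) (toℕ-mod (m ℕ.∸ toℕ x)) ⟩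
    (toℕ x ℕ.+ (m ℕ.∸ toℕ x) ℕ.% m) ℕ.% m    ≡⟨ %-absorbʳ (toℕ x) (m ℕ.∸ toℕ x) ⟩
    (toℕ x ℕ.+ (m ℕ.∸ toℕ x)) ℕ.% m          ≡⟨ cong (ℕ._% m) (ℕP.m+[n∸m]≡n (ℕP.<⇒≤ (toℕ<n x))) ⟩
    m ℕ.% m                                  ≡⟨ n%n≡0 m ⟩
    0                                        ≡⟨ toℕ-0̂ ⟨
    toℕ 0̂                                    ∎)
    where open ≡-Reasoning

  ⊖-inverseʳ : ∀ x d → x ⊕ d ⊕ ⊖ d ≡ x
  ⊖-inverseʳ x d = trans (⊕-assoc x d (⊖ d)) (trans (cong (x ⊕_) (⊕-inverseʳ d)) (⊕-identityʳ x))

  ⊖-inverseˡ : ∀ x d → x ⊕ ⊖ d ⊕ d ≡ x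
  ⊖-inverseˡ x d = trans (⊕-assoc x (⊖ d) d) (trans (cong (x ⊕_) (trans (⊕-comm (⊖ d) d) (⊕-inverseʳ d)))
                                                    (⊕-identityʳ x))

  ⊕-cancelˡ : ∀ x {a b} → x ⊕ a ≡ x ⊕ b → a ≡ b
  ⊕-cancelˡ x {a} {b} eq = begin
    a            ≡⟨ ⊖-inverseʳ a x ⟨
    a ⊕ x ⊕ ⊖ x  ≡⟨ cong (_⊕ ⊖ x) (trans (⊕-comm a x) (trans eq (⊕-comm x b))) ⟩
    b ⊕ x ⊕ ⊖ x  ≡⟨ ⊖-inverseʳ b x ⟩
    b            ∎
    where open ≡-Reasoning

  ⊕-difference : ∀ x t → x ⊕ (t ⊕ ⊖ x) ≡ t
  ⊕-difference x t = trans (⊕-comm x (t ⊕ ⊖ x)) (⊖-inverseˡ t x)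

  sum-rotate : ∀ d (f : Fin m → ℚ) → ∑[ x < m ] f (x ⊕ d) ≡ sum f
  sum-rotate d f = sym (∑-permute f (permutation (_⊕ d) (_⊕ ⊖ d) (λ x → ⊖-inverseˡ x d)
                                                                  (λ x → ⊖-inverseʳ x d)))

  toℕ-⊕1̂ : ∀ i → toℕ (i ⊕ 1̂) ≡ suc (toℕ i) ℕ.% m
  toℕ-⊕1̂ i = begin
    toℕ (i ⊕ 1̂)                ≡⟨ toℕ-⊕ i 1̂ ⟩
    (toℕ i ℕ.+ toℕ 1̂) ℕ.% m    ≡⟨ cong (λ c → (toℕ i ℕ.+ c) ℕ.% m) (toℕ-mod 1) ⟩
    (toℕ i ℕ.+ 1 ℕ.% m) ℕ.% m  ≡⟨ %-absorbʳ (toℕ i) 1 ⟩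
    (toℕ i ℕ.+ 1) ℕ.% m        ≡⟨ cong (ℕ._% m) (ℕP.+-comm (toℕ i) 1) ⟩
    suc (toℕ i) ℕ.% m          ∎
    where open ≡-Reasoning

  -- The two disjuncts of `cycAdj m i j` in which j comes right after i.
  successor-spec : ∀ i j →
    T ((suc (toℕ i) ℕ.≡ᵇ toℕ j) ∨ ((toℕ j ℕ.≡ᵇ 0) ∧ (suc (toℕ i) ℕ.≡ᵇ m))) ⇔ j ≡ i ⊕ 1̂
  successor-spec i j = mk⇔ to from
    where
    open ≡-Reasoning
    next wraps : Bool
    next  = suc (toℕ i) ℕ.≡ᵇ toℕ j
    wraps = (toℕ j ℕ.≡ᵇ 0) ∧ (suc (toℕ i) ℕ.≡ᵇ m)
    to : T (next ∨ wraps) → j ≡ i ⊕ 1̂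
    to t with Equivalence.to (Bool.T-∨ {next} {wraps}) t
    ... | inj₁ t-next = toℕ-injective (sym (begin
      toℕ (i ⊕ 1̂)        ≡⟨ toℕ-⊕1̂ i ⟩
      suc (toℕ i) ℕ.% m  ≡⟨ m<n⇒m%n≡m (subst (ℕ._< m) (sym i+1≡j) (toℕ<n j)) ⟩
      suc (toℕ i)        ≡⟨ i+1≡j ⟩
      toℕ j              ∎))
      where
      i+1≡j : suc (toℕ i) ≡ toℕ j
      i+1≡j = ℕP.≡ᵇ⇒≡ _ _ t-next
    ... | inj₂ t-wraps with Equivalence.to (Bool.T-∧ {toℕ j ℕ.≡ᵇ 0}) t-wraps
    ... | j≡0 , i+1≡m = toℕ-injective (begin
      toℕ j              ≡⟨ ℕP.≡ᵇ⇒≡ _ 0 j≡0 ⟩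
      0                  ≡⟨ n%n≡0 m ⟨
      m ℕ.% m            ≡⟨ cong (ℕ._% m) (ℕP.≡ᵇ⇒≡ _ _ i+1≡m) ⟨
      suc (toℕ i) ℕ.% m  ≡⟨ toℕ-⊕1̂ i ⟨
      toℕ (i ⊕ 1̂)        ∎)
    from : j ≡ i ⊕ 1̂ → T (next ∨ wraps)
    from j≡i+1 with suc (toℕ i) ℕ.<? m
    ... | yes i+1<m = Equivalence.from (Bool.T-∨ {next} {wraps})
      (inj₁ (ℕP.≡⇒≡ᵇ _ _ (sym (trans j-val (m<n⇒m%n≡m i+1<m)))))
      where
      j-val : toℕ j ≡ suc (toℕ i) ℕ.% m
      j-val = trans (cong toℕ j≡i+1) (toℕ-⊕1̂ i)
    ... | no  i+1≮m = Equivalence.from (Bool.T-∨ {next} {wraps})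
      (inj₂ (Equivalence.from (Bool.T-∧ {toℕ j ℕ.≡ᵇ 0})
        ( ℕP.≡⇒≡ᵇ _ 0 (trans j-val (trans (cong (ℕ._% m) i+1≡m) (n%n≡0 m)))
        , ℕP.≡⇒≡ᵇ _ _ i+1≡m)))
      where
      j-val : toℕ j ≡ suc (toℕ i) ℕ.% m
      j-val = trans (cong toℕ j≡i+1) (toℕ-⊕1̂ i)
      i+1≡m : suc (toℕ i) ≡ m
      i+1≡m = ℕP.≤-antisym (toℕ<n i) (ℕP.≮⇒≥ i+1≮m)

  cycAdj≡ : ∀ i j → cycAdj m i j ≡ does (j ≟ i ⊕ 1̂) ∨ does (i ≟ j ⊕ 1̂)
  cycAdj≡ i j = trans
    (∨-regroup (suc (toℕ i) ℕ.≡ᵇ toℕ j) (suc (toℕ j) ℕ.≡ᵇ toℕ i)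
               ((toℕ i ℕ.≡ᵇ 0) ∧ (suc (toℕ j) ℕ.≡ᵇ m)) ((toℕ j ℕ.≡ᵇ 0) ∧ (suc (toℕ i) ℕ.≡ᵇ m)))
    (cong₂ _∨_ (does-⇔ (successor-spec i j) (T? _) (j ≟ i ⊕ 1̂))
               (does-⇔ (successor-spec j i) (T? _) (i ≟ j ⊕ 1̂)))
    where
    ∨-regroup : ∀ a b c d → a ∨ b ∨ c ∨ d ≡ (a ∨ d) ∨ (b ∨ c)
    ∨-regroup true  b c d = refl
    ∨-regroup false b c d = trans (sym (Bool.∨-assoc b c d)) (Bool.∨-comm (b ∨ c) d)

  cycAdj⇒ : ∀ i j → cycAdj m i j ≡ true → j ≡ i ⊕ 1̂ ⊎ i ≡ j ⊕ 1̂
  cycAdj⇒ i j adj with j ≟ i ⊕ 1̂ | i ≟ j ⊕ 1̂ | trans (sym adj) (cycAdj≡ i j)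
  ... | yes j≡i+1 | _         | _ = inj₁ j≡i+1
  ... | no  _     | yes i≡j+1 | _ = inj₂ i≡j+1
  ... | no  _     | no  _     | ()

  ≟-rotate : ∀ x a b → does (x ⊕ a ≟ x ⊕ b) ≡ does (a ≟ b)
  ≟-rotate x a b = does-⇔ (mk⇔ (⊕-cancelˡ x) (cong (x ⊕_))) (x ⊕ a ≟ x ⊕ b) (a ≟ b)

  cycAdj-rotate : ∀ x a b → cycAdj m (x ⊕ a) (x ⊕ b) ≡ cycAdj m a b
  cycAdj-rotate x a b = begin
    cycAdj m (x ⊕ a) (x ⊕ b)                             ≡⟨ cycAdj≡ (x ⊕ a) (x ⊕ b) ⟩
    does (x ⊕ b ≟ x ⊕ a ⊕ 1̂) ∨ does (x ⊕ a ≟ x ⊕ b ⊕ 1̂)  ≡⟨ cong₂ _∨_ (follows a b) (follows b a) ⟩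
    does (b ≟ a ⊕ 1̂) ∨ does (a ≟ b ⊕ 1̂)                  ≡⟨ cycAdj≡ a b ⟨
    cycAdj m a b                                          ∎
    where
    open ≡-Reasoning
    follows : ∀ a b → does (x ⊕ b ≟ x ⊕ a ⊕ 1̂) ≡ does (b ≟ a ⊕ 1̂)
    follows a b = does-⇔ (mk⇔ (λ e → ⊕-cancelˡ x (trans e (⊕-assoc x a 1̂)))
                              (λ e → trans (cong (x ⊕_) e) (sym (⊕-assoc x a 1̂))))
                         (x ⊕ b ≟ x ⊕ a ⊕ 1̂) (b ≟ a ⊕ 1̂)

module WheelRotation (m : ℕ) .{{_ : ℕ.NonZero m}} where

  open Cyclic m

  rotate : Fin m → Fin (suc m) → Fin (suc m)
  rotate x zero    = zero
  rotate x (suc a) = suc (x ⊕ a)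

  rotate-injective : ∀ x → Injective _≡_ _≡_ (rotate x)
  rotate-injective x {zero}  {zero}  _  = refl
  rotate-injective x {suc a} {suc b} eq = cong suc (⊕-cancelˡ x (suc-injective eq))

  rotate-surjective : ∀ x u → ∃[ u′ ] u ≡ rotate x u′
  rotate-surjective x zero    = zero , refl
  rotate-surjective x (suc t) = suc (t ⊕ ⊖ x) , cong suc (sym (⊕-difference x t))

  dist₂-rotate : ∀ x u v → dist₂ (wheel (suc m)) (rotate x u) (rotate x v) ≡ dist₂ (wheel (suc m)) u v
  dist₂-rotate x zero    zero    = refl
  dist₂-rotate x zero    (suc b) = refl
  dist₂-rotate x (suc a) zero    = refl
  dist₂-rotate x (suc a) (suc b) =
    cong₂ (λ same adj → if same then 0 else if adj then 1 else 2) (≟-rotate x a b) (cycAdj-rotate x a b)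

ldimF-W₄ : LdimF≡ (wheel 4) (ℤ.+ 2 / 1)
ldimF-W₄ = ldimF≡-certified (wheel 4) (λ _ → ℤ.+ 1 / 2)
  (fromList ((0F , 1F) ∷ (0F , 2F) ∷ (0F , 3F) ∷ (1F , 2F) ∷ (1F , 3F) ∷ (2F , 3F) ∷ [])) 2

ldimF-W₅ : LdimF≡ (wheel 5) (ℤ.+ 3 / 2)
ldimF-W₅ = ldimF≡-certified (wheel 5) (λ { 0F → ℤ.+ 1 / 2 ; (suc _) → ¼ })
  (fromList ((0F , 1F) ∷ (0F , 2F) ∷ (1F , 2F) ∷ [])) 1

-- Every spoke is listed twice: then each vertex resolves exactly 10 of the 15 edges.
ldimF-W₆ : LdimF≡ (wheel 6) (ℤ.+ 3 / 2)
ldimF-W₆ = ldimF≡-certified (wheel 6) (λ _ → ¼)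
  (fromList ((1F , 2F) ∷ (2F , 3F) ∷ (3F , 4F) ∷ (4F , 5F) ∷ (5F , 1F)
           ∷ (0F , 1F) ∷ (0F , 2F) ∷ (0F , 3F) ∷ (0F , 4F) ∷ (0F , 5F)
           ∷ (0F , 1F) ∷ (0F , 2F) ∷ (0F , 3F) ∷ (0F , 4F) ∷ (0F , 5F) ∷ [])) 9

module WheelOfOrderAtLeast7 (j : ℕ) where

  m : ℕ
  m = suc (suc (suc (suc (suc (suc j)))))

  W : Graph (suc m)
  W = wheel (suc m)

  open Cyclic m
  open WheelRotation m

  resolves₂ : Fin (suc m) → Fin (suc m) → Fin (suc m) → Bool
  resolves₂ v w u = not (dist₂ W v u ℕ.≡ᵇ dist₂ W w u)

  resolves-rotate : ∀ x v w u → resolvesᵇ W (rotate x v) (rotate x w) (rotate x u) ≡ resolves₂ v w u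
  resolves-rotate x v w u = cong₂ (λ p q → not (p ℕ.≡ᵇ q))
    (trans (dist≡dist₂ W (rotate x v) (rotate x u) (wheel-reach₂ _ (rotate x v) (rotate x u))) (dist₂-rotate x v u))
    (trans (dist≡dist₂ W (rotate x w) (rotate x u) (wheel-reach₂ _ (rotate x w) (rotate x u))) (dist₂-rotate x w u))

  -- The rim edge {x+1, x+2} is resolved by x + window k, k < 4, i.e. by x, x+1, x+2, x+3 …
  window : Fin 4 → Fin m
  window k = k ↑ˡ suc (suc j)

  -- … and the spoke to y by y + spokeWindow k, i.e. by y and the non-neighbours y+2, y+3, y+4.
  spokeWindow : Fin 4 → Fin m
  spokeWindow k = punchIn 1F k ↑ˡ suc j

  window-resolves : ∀ k → resolves₂ 2F 3F (suc (window k)) ≡ true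
  window-resolves 0F = refl
  window-resolves 1F = refl
  window-resolves 2F = refl
  window-resolves 3F = refl

  -- The omitted cases are those where `resolves₂ 2F 3F u` computes to `false`.
  window-covers : ∀ u → resolves₂ 2F 3F u ≡ true → ∃[ k ] u ≡ suc (window k)
  window-covers 1F _ = 0F , refl
  window-covers 2F _ = 1F , refl
  window-covers 3F _ = 2F , refl
  window-covers 4F _ = 3F , refl

  spokeWindow-resolves : ∀ k → resolves₂ 0F 1F (suc (spokeWindow k)) ≡ true
  spokeWindow-resolves 0F = refl
  spokeWindow-resolves 1F = refl
  spokeWindow-resolves 2F = refl
  spokeWindow-resolves 3F = refl

  ϑ₀ : Fin (suc m) → ℚ
  ϑ₀ zero    = 0ℚ
  ϑ₀ (suc _) = ¼

  ϑ₀-bounds : ∀ u → (0ℚ ≤ ϑ₀ u) × (ϑ₀ u ≤ 1ℚ)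
  ϑ₀-bounds zero    = from-yes (0ℚ ≤? 0ℚ) , from-yes (0ℚ ≤? 1ℚ)
  ϑ₀-bounds (suc _) = from-yes (0ℚ ≤? ¼) , from-yes (¼ ≤? 1ℚ)

  ϑ₀-nonNeg : ∀ u → 0ℚ ≤ ϑ₀ u
  ϑ₀-nonNeg = proj₁ ∘ ϑ₀-bounds

  spoke-resolving : ∀ y → 1ℚ ≤ resolvingSum W ϑ₀ zero (suc y)
  spoke-resolving y =
    resolvingSum-≥ W ϑ₀ zero (suc y) (rotate y ∘ suc ∘ spokeWindow) injective ϑ₀-nonNeg resolved
    where
    injective : Injective _≡_ _≡_ (rotate y ∘ suc ∘ spokeWindow)
    injective = punchIn-injective 1F _ _ ∘ ↑ˡ-injective _ _ _ ∘ suc-injective ∘ rotate-injective y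
    resolved : ∀ k → resolvesᵇ W zero (suc y) (rotate y (suc (spokeWindow k))) ≡ true
    resolved k = begin
      resolvesᵇ W zero (suc y) u                 ≡⟨ cong (λ c → resolvesᵇ W zero (suc c) u) (⊕-identityʳ y) ⟨
      resolvesᵇ W (rotate y 0F) (rotate y 1F) u  ≡⟨ resolves-rotate y 0F 1F (suc (spokeWindow k)) ⟩
      resolves₂ 0F 1F (suc (spokeWindow k))      ≡⟨ spokeWindow-resolves k ⟩
      true                                       ∎
      where
      open ≡-Reasoning
      u : Fin (suc m)
      u = rotate y (suc (spokeWindow k))

  rim-resolving : ∀ i → 1ℚ ≤ resolvingSum W ϑ₀ (suc i) (suc (i ⊕ 1̂))
  rim-resolving i =
    resolvingSum-≥ W ϑ₀ (suc i) (suc (i ⊕ 1̂)) (rotate x ∘ suc ∘ window) injective ϑ₀-nonNeg resolved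
    where
    x : Fin m
    x = i ⊕ ⊖ 1̂
    injective : Injective _≡_ _≡_ (rotate x ∘ suc ∘ window)
    injective = ↑ˡ-injective _ _ _ ∘ suc-injective ∘ rotate-injective x
    x+1≡i : rotate x 2F ≡ suc i
    x+1≡i = cong suc (⊖-inverseˡ i 1̂)
    x+2≡i+1 : rotate x 3F ≡ suc (i ⊕ 1̂)
    x+2≡i+1 = cong suc (trans (sym (⊕-assoc x 1̂ 1̂)) (cong (_⊕ 1̂) (⊖-inverseˡ i 1̂)))
    resolved : ∀ k → resolvesᵇ W (suc i) (suc (i ⊕ 1̂)) (rotate x (suc (window k))) ≡ true
    resolved k = begin
      resolvesᵇ W (suc i) (suc (i ⊕ 1̂)) u    ≡⟨ cong₂ (λ v w → resolvesᵇ W v w u) x+1≡i x+2≡i+1 ⟨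
      resolvesᵇ W (rotate x 2F) (rotate x 3F) u  ≡⟨ resolves-rotate x 2F 3F (suc (window k)) ⟩
      resolves₂ 2F 3F (suc (window k))           ≡⟨ window-resolves k ⟩
      true                                       ∎
      where
      open ≡-Reasoning
      u : Fin (suc m)
      u = rotate x (suc (window k))

  rim-edge-resolving : ∀ i i′ → i′ ≡ i ⊕ 1̂ ⊎ i ≡ i′ ⊕ 1̂ → 1ℚ ≤ resolvingSum W ϑ₀ (suc i) (suc i′)
  rim-edge-resolving i _  (inj₁ refl) = rim-resolving i
  rim-edge-resolving _ i′ (inj₂ refl) =
    subst (1ℚ ≤_) (resolvingSum-comm W ϑ₀ (suc i′) (suc (i′ ⊕ 1̂))) (rim-resolving i′)

  ϑ₀-resolving : ∀ v w → W v w ≡ true → 1ℚ ≤ resolvingSum W ϑ₀ v w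
  ϑ₀-resolving zero    (suc y)  _   = spoke-resolving y
  ϑ₀-resolving (suc y) zero     _   = subst (1ℚ ≤_) (resolvingSum-comm W ϑ₀ zero (suc y)) (spoke-resolving y)
  ϑ₀-resolving (suc i) (suc i′) adj = rim-edge-resolving i i′ (cycAdj⇒ i i′ adj)

  sum-ϑ₀ : sumℚ ϑ₀ ≡ ℤ.+ m / 4
  sum-ϑ₀ = begin
    sumℚ ϑ₀            ≡⟨ sumℚ≡sum ϑ₀ ⟩
    0ℚ + ∑[ t < m ] ¼  ≡⟨ +-identityˡ _ ⟩
    ∑[ t < m ] ¼       ≡⟨ sum-replicate m {¼} ⟩
    m · ¼              ≡⟨ ·-¼ m ⟩
    ℤ.+ m / 4          ∎
    where open ≡-Reasoning

  module _ (ϑ : Fin (suc m) → ℚ) (lrf : IsLocalResolvingFunction W ϑ) where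

    private
      ϑ≥0 : ∀ u → 0ℚ ≤ ϑ u
      ϑ≥0 u = proj₁ (proj₁ lrf u)

    rim-window-≥ : ∀ x → 1ℚ ≤ ∑[ k < 4 ] ϑ (rotate x (suc (window k)))
    rim-window-≥ x = ≤-trans (proj₂ lrf (rotate x 2F) (rotate x 3F) (cycAdj-rotate x 1F 2F))
                             (resolvingSum-≤ W ϑ (rotate x 2F) (rotate x 3F) (rotate x ∘ suc ∘ window) ϑ≥0 covered)
      where
      covered : ∀ u → resolvesᵇ W (rotate x 2F) (rotate x 3F) u ≡ true → ∃[ k ] u ≡ rotate x (suc (window k))
      covered u resolved =
        let u′ , u≡xu′ = rotate-surjective x u
            k  , u′≡k  = window-covers u′ (trans (sym (resolves-rotate x 2F 3F u′))
                           (subst (λ z → resolvesᵇ W (rotate x 2F) (rotate x 3F) z ≡ true) u≡xu′ resolved))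
        in k , trans u≡xu′ (cong (rotate x) u′≡k)

    rim-total : m · 1ℚ ≤ 4 · sum (ϑ ∘ suc)
    rim-total = begin
      m · 1ℚ                                         ≡⟨ sum-replicate m {1ℚ} ⟨
      ∑[ x < m ] 1ℚ                                  ≤⟨ sum-mono-≤ rim-window-≥ ⟩
      ∑[ x < m ] ∑[ k < 4 ] ϑ (suc (x ⊕ window k))  ≡⟨ ∑-comm (λ x k → ϑ (suc (x ⊕ window k))) ⟩
      ∑[ k < 4 ] ∑[ x < m ] ϑ (suc (x ⊕ window k))  ≡⟨ sum-cong-≗ (λ k → sum-rotate (window k) (ϑ ∘ suc)) ⟩
      ∑[ k < 4 ] sum (ϑ ∘ suc)                       ≡⟨ sum-replicate 4 {sum (ϑ ∘ suc)} ⟩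
      4 · sum (ϑ ∘ suc)                              ∎
      where open ℚ.≤-Reasoning

    ldimF-≥ : ℤ.+ m / 4 ≤ sumℚ ϑ
    ldimF-≥ = begin
      ℤ.+ m / 4               ≡⟨ ·-¼ m ⟨
      m · ¼                   ≤⟨ ·-cancelˡ-≤ 3 (subst (_≤ 4 · sum (ϑ ∘ suc)) four-quarters rim-total) ⟩
      sum (ϑ ∘ suc)           ≤⟨ sum-injective-≤ suc suc-injective ϑ≥0 ⟩
      ϑ zero + sum (ϑ ∘ suc)  ≡⟨ sumℚ≡sum ϑ ⟨
      sumℚ ϑ                  ∎
      where
      open ℚ.≤-Reasoning
      four-quarters : m · 1ℚ ≡ 4 · (m · ¼)
      four-quarters = begin-equality
        m · 1ℚ         ≡⟨ ×-assocˡ ¼ m 4 ⟩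
        (m ℕ.* 4) · ¼  ≡⟨ cong (_· ¼) (ℕP.*-comm m 4) ⟩
        (4 ℕ.* m) · ¼  ≡⟨ ×-assocˡ ¼ 4 m ⟨
        4 · (m · ¼)    ∎

  ldimF-W : LdimF≡ W (ℤ.+ m / 4)
  ldimF-W = (ϑ₀ , (ϑ₀-bounds , ϑ₀-resolving) , sum-ϑ₀) , ldimF-≥

  -- Transporting along this equation keeps Agda from unfolding every `resolvingSum W` in
  -- `LdimF≡ W _` when comparing `W` with the literal wheel of order 7 + j.
  W≡wheel : W ≡ wheel (suc (suc (suc (suc (suc (suc (suc j)))))))
  W≡wheel = refl

  ldimF : LdimF≡ (wheel (suc (suc (suc (suc (suc (suc (suc j)))))))) (ℤ.+ m / 4)
  ldimF = subst (λ G → LdimF≡ G (ℤ.+ m / 4)) W≡wheel ldimF-W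

lemma3p2 : (n : ℕ) → 4 ℕ.≤ n → LdimF≡ (wheel n) (ldimWheel n)
lemma3p2 1 (s≤s ())
lemma3p2 2 (s≤s (s≤s ()))
lemma3p2 3 (s≤s (s≤s (s≤s ())))
lemma3p2 4 _ = ldimF-W₄
lemma3p2 5 _ = ldimF-W₅
lemma3p2 6 _ = ldimF-W₆
lemma3p2 (suc (suc (suc (suc (suc (suc (suc j))))))) _ = WheelOfOrderAtLeast7.ldimF j
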